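{- $(\text{biKA},\{a\cdot a\leq a\})$ and $(\text{biKA},\{a\parallel a\leq a\})$ both reduce to $(\text{biKA},\emptyset)$.
   Context: Take $\Sigma=\{\cdot,\parallel,1\}$ and $E$ the bimonoid equations ($(\cdot,1)$ a monoid, $(\parallel,1)$ a commutative monoid); atoms are series-parallel pomsets. Expressions are restricted to the fragment where every fixpoint is $e^*=\mu x.1+e\cdot x$ or $e^{\parallel}=\mu x.1+e\parallel x$ (bi-Kleene algebra expressions), and biKA is the bi-Kleene algebra axiomatisation, which is sound and complete for the empty set of hypotheses. $[\![e]\!]_E$ is the standard language interpretation (sets of series-parallel pomsets). For a set $H$ of hypotheses, $H^*(L)$ is the least language containing $L$ closed under: if $C[\![f]\!]_E\subseteq L$ for a context $C$ and $(e\leq f)\in H$, then $C[\![e]\!]_E\subseteq L$. The representation $(Q,H)$ interprets $e$ as $H^*[\![e]\!]_E$ with equivalence $e\equiv f$ iff $Q,H\vdash e\leq f$ and $Q,H\vdash f\leq e$. $(Q,H)$ reduces to $(Q',H')$ if there are maps $r,i$ on expressions and $\iota$ from $H$-closed to $H'$-closed languages such that: $e'\equiv' f'$ implies $i(e')\equiv i(f')$; $i(r(e))\equiv e$; and $\iota(H^*[\![e]\!]_E)=H'^*[\![r(e)]\!]_E$. Completeness transfers along reductions. -}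

module Defs where

open import Data.Empty using (⊥)
open import Data.Product using (Σ; _×_; _,_; proj₁)
open import Relation.Binary.PropositionalEquality using (_≡_)

module _ (A : Set) where

  infixl 7 _·_
  infixl 6 _∥_
  data Term : Set where
    atom : A → Term
    one  : Term
    _·_  : Term → Term → Term
    _∥_  : Term → Term → Term

  -- E: bimonoid equations; ≈E is the generated congruence.
  -- Series-parallel pomsets = Term / ≈E.
  infix 4 _≈E_
  data _≈E_ : Term → Term → Set where
    ·-assoc  : ∀ s t u → (s · t) · u ≈E s · (t · u)
    ·-unitˡ  : ∀ t → one · t ≈E t
    ·-unitʳ  : ∀ t → t · one ≈E t
    ∥-assoc  : ∀ s t u → (s ∥ t) ∥ u ≈E s ∥ (t ∥ u)
    ∥-comm   : ∀ s t → s ∥ t ≈E t ∥ s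
    ∥-unitˡ  : ∀ t → one ∥ t ≈E t
    E-refl   : ∀ t → t ≈E t
    E-sym    : ∀ {s t} → s ≈E t → t ≈E s
    E-trans  : ∀ {s t u} → s ≈E t → t ≈E u → s ≈E u
    ·-cong   : ∀ {s s' t t'} → s ≈E s' → t ≈E t' → s · t ≈E s' · t'
    ∥-cong   : ∀ {s s' t t'} → s ≈E s' → t ≈E t' → s ∥ t ≈E s' ∥ t'

  -- Languages: (E-closed) sets of series-parallel pomsets, as predicates
  Lang : Set₁
  Lang = Term → Set

  infix 4 _⊆L_ _≐L_
  _⊆L_ : Lang → Lang → Set
  L ⊆L M = ∀ t → L t → M t

  _≐L_ : Lang → Lang → Set
  L ≐L M = (L ⊆L M) × (M ⊆L L)

  infixl 5 _⊕_
  infixl 7 _⊙_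
  infixl 6 _∣∣_
  infix 8 _⋆ _⋆∥
  data Exp : Set where
    𝟘 𝟙   : Exp
    var   : A → Exp
    _⊕_   : Exp → Exp → Exp
    _⊙_   : Exp → Exp → Exp
    _∣∣_  : Exp → Exp → Exp
    _⋆    : Exp → Exp
    _⋆∥   : Exp → Exp      -- e^∥ = μx.1 + e∥x

  data ⟦_⟧ : Exp → Lang where
    sem-one  : ⟦ 𝟙 ⟧ one
    sem-var  : ∀ x → ⟦ var x ⟧ (atom x)
    sem-inl  : ∀ {e f t} → ⟦ e ⟧ t → ⟦ e ⊕ f ⟧ t
    sem-inr  : ∀ {e f t} → ⟦ f ⟧ t → ⟦ e ⊕ f ⟧ t
    sem-seq  : ∀ {e f s t} → ⟦ e ⟧ s → ⟦ f ⟧ t → ⟦ e ⊙ f ⟧ (s · t)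
    sem-par  : ∀ {e f s t} → ⟦ e ⟧ s → ⟦ f ⟧ t → ⟦ e ∣∣ f ⟧ (s ∥ t)
    sem-star0 : ∀ {e} → ⟦ e ⋆ ⟧ one
    sem-starS : ∀ {e s t} → ⟦ e ⟧ s → ⟦ e ⋆ ⟧ t → ⟦ e ⋆ ⟧ (s · t)
    sem-pstar0 : ∀ {e} → ⟦ e ⋆∥ ⟧ one
    sem-pstarS : ∀ {e s t} → ⟦ e ⟧ s → ⟦ e ⋆∥ ⟧ t → ⟦ e ⋆∥ ⟧ (s ∥ t)
    sem-E    : ∀ {e s t} → ⟦ e ⟧ s → s ≈E t → ⟦ e ⟧ t

  -- Hypotheses: a set of inequations e ≤ f (not closed under substitution)

  Hyp : Set₁
  Hyp = Exp → Exp → Set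

  ∅H : Hyp
  ∅H _ _ = ⊥

  data Ctx : Set where
    hole : Ctx
    _·ˡ_ : Ctx → Term → Ctx
    _·ʳ_ : Term → Ctx → Ctx
    _∥ˡ_ : Ctx → Term → Ctx
    _∥ʳ_ : Term → Ctx → Ctx

  plug : Ctx → Term → Term
  plug hole      u = u
  plug (C ·ˡ t)  u = plug C u · t
  plug (t ·ʳ C)  u = t · plug C u
  plug (C ∥ˡ t)  u = plug C u ∥ t
  plug (t ∥ʳ C)  u = t ∥ plug C u

  data HStar (H : Hyp) (L : Lang) : Lang where
    hs-base : ∀ {t} → L t → HStar H L t
    hs-E    : ∀ {s t} → HStar H L s → s ≈E t → HStar H L t
    hs-hyp  : ∀ {e f} → H e f → (C : Ctx) →
              (∀ t → ⟦ f ⟧ t → HStar H L (plug C t)) →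
              ∀ s → ⟦ e ⟧ s → HStar H L (plug C s)

  HClosed : Hyp → Lang → Set
  HClosed H L = HStar H L ⊆L L

  ClosedLang : Hyp → Set₁
  ClosedLang H = Σ Lang (HClosed H)

  HStar-closed : ∀ H L → HClosed H (HStar H L)
  HStar-closed H L t (hs-base p) = p
  HStar-closed H L t (hs-E p q) = hs-E (HStar-closed H L _ p) q
  HStar-closed H L t (hs-hyp h C k s es) =
    hs-hyp h C (λ u fu → HStar-closed H L _ (k u fu)) s es

  interp : (H : Hyp) → Exp → ClosedLang H
  interp H e = HStar H ⟦ e ⟧ , HStar-closed H ⟦ e ⟧

  infix 3 _⊢_≐_ _⊢_≤_ _⊢_≡_
  data _⊢_≐_ (H : Hyp) : Exp → Exp → Set

  _⊢_≤_ : Hyp → Exp → Exp → Set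
  H ⊢ e ≤ f = H ⊢ e ⊕ f ≐ f

  data _⊢_≐_ H where
    ≐-refl  : ∀ {e} → H ⊢ e ≐ e
    ≐-sym   : ∀ {e f} → H ⊢ e ≐ f → H ⊢ f ≐ e
    ≐-trans : ∀ {e f g} → H ⊢ e ≐ f → H ⊢ f ≐ g → H ⊢ e ≐ g
    ⊕-cong  : ∀ {e e' f f'} → H ⊢ e ≐ e' → H ⊢ f ≐ f' → H ⊢ e ⊕ f ≐ e' ⊕ f'
    ⊙-cong  : ∀ {e e' f f'} → H ⊢ e ≐ e' → H ⊢ f ≐ f' → H ⊢ e ⊙ f ≐ e' ⊙ f'
    ∣∣-cong : ∀ {e e' f f'} → H ⊢ e ≐ e' → H ⊢ f ≐ f' → H ⊢ e ∣∣ f ≐ e' ∣∣ f'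
    ⋆-cong  : ∀ {e e'} → H ⊢ e ≐ e' → H ⊢ e ⋆ ≐ e' ⋆
    ⋆∥-cong : ∀ {e e'} → H ⊢ e ≐ e' → H ⊢ e ⋆∥ ≐ e' ⋆∥
    ⊕-assoc : ∀ {e f g} → H ⊢ (e ⊕ f) ⊕ g ≐ e ⊕ (f ⊕ g)
    ⊕-comm  : ∀ {e f} → H ⊢ e ⊕ f ≐ f ⊕ e
    ⊕-idem  : ∀ {e} → H ⊢ e ⊕ e ≐ e
    ⊕-unit  : ∀ {e} → H ⊢ 𝟘 ⊕ e ≐ e
    ⊙-assoc : ∀ {e f g} → H ⊢ (e ⊙ f) ⊙ g ≐ e ⊙ (f ⊙ g)
    ⊙-unitˡ : ∀ {e} → H ⊢ 𝟙 ⊙ e ≐ e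
    ⊙-unitʳ : ∀ {e} → H ⊢ e ⊙ 𝟙 ≐ e
    ⊙-zeroˡ : ∀ {e} → H ⊢ 𝟘 ⊙ e ≐ 𝟘
    ⊙-zeroʳ : ∀ {e} → H ⊢ e ⊙ 𝟘 ≐ 𝟘
    ⊙-distribˡ : ∀ {e f g} → H ⊢ e ⊙ (f ⊕ g) ≐ e ⊙ f ⊕ e ⊙ g
    ⊙-distribʳ : ∀ {e f g} → H ⊢ (e ⊕ f) ⊙ g ≐ e ⊙ g ⊕ f ⊙ g
    ∣∣-assoc : ∀ {e f g} → H ⊢ (e ∣∣ f) ∣∣ g ≐ e ∣∣ (f ∣∣ g)
    ∣∣-comm  : ∀ {e f} → H ⊢ e ∣∣ f ≐ f ∣∣ e
    ∣∣-unit  : ∀ {e} → H ⊢ 𝟙 ∣∣ e ≐ e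
    ∣∣-zero  : ∀ {e} → H ⊢ 𝟘 ∣∣ e ≐ 𝟘
    ∣∣-distrib : ∀ {e f g} → H ⊢ e ∣∣ (f ⊕ g) ≐ e ∣∣ f ⊕ e ∣∣ g
    ⋆-unfoldˡ : ∀ {e} → H ⊢ 𝟙 ⊕ e ⊙ e ⋆ ≤ e ⋆
    ⋆-unfoldʳ : ∀ {e} → H ⊢ 𝟙 ⊕ e ⋆ ⊙ e ≤ e ⋆
    ⋆-indˡ : ∀ {e f g} → H ⊢ f ⊕ e ⊙ g ≤ g → H ⊢ e ⋆ ⊙ f ≤ g
    ⋆-indʳ : ∀ {e f g} → H ⊢ f ⊕ g ⊙ e ≤ g → H ⊢ f ⊙ e ⋆ ≤ g
    ⋆∥-unfold : ∀ {e} → H ⊢ 𝟙 ⊕ e ∣∣ e ⋆∥ ≤ e ⋆∥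
    ⋆∥-ind : ∀ {e f g} → H ⊢ f ⊕ e ∣∣ g ≤ g → H ⊢ e ⋆∥ ∣∣ f ≤ g
    -- hypotheses (used as given, not substituted)
    hyp : ∀ {e f} → H e f → H ⊢ e ≤ f

  _⊢_≡_ : Hyp → Exp → Exp → Set
  H ⊢ e ≡ f = (H ⊢ e ≤ f) × (H ⊢ f ≤ e)

  record Reduces (H H' : Hyp) : Set₁ where
    field
      r : Exp → Exp
      i : Exp → Exp
      ι : ClosedLang H → ClosedLang H'
      -- ι is a function on languages (respects language equality)
      ι-ext : ∀ L M → proj₁ L ≐L proj₁ M → proj₁ (ι L) ≐L proj₁ (ι M)
      i-hom : ∀ e f → H' ⊢ e ≡ f → H ⊢ i e ≡ i f
      i∘r   : ∀ e → H ⊢ i (r e) ≡ e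
      ι-r   : ∀ e → proj₁ (ι (interp H e)) ≐L HStar H' ⟦ r e ⟧

  SeqIdem : A → Hyp
  SeqIdem a e f = (e ≡ var a ⊙ var a) × (f ≡ var a)

  ParIdem : A → Hyp
  ParIdem a e f = (e ≡ var a ∣∣ var a) × (f ≡ var a)

-- Write a⁺ for a·a* (resp. a∥a^∥). The reduction r substitutes a⁺ for a, and i is the
-- identity: the hypothesis a·a ≤ a makes a⁺ ≡ a, so i (r e) ≡ e. The heart of the proof is
-- H*[[e]] = [[r e]]. The right-hand side is [[e]] with occurrences of a replaced by nonempty
-- powers of a. It contains [[e]]; it is H-closed because such replacements commute with the
-- bimonoid equations and with contexts, and a use of the hypothesis in a context C turns C[a]
-- into C[a·a], which is one such replacement; and it lies inside H*[[e]] because the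
-- hypothesis collapses every power of a back to a.
module Submission where

open import Data.Empty using (⊥-elim)
open import Data.Product using (∃-syntax; ∃₂; _×_; _,_; proj₁; proj₂; swap)
open import Data.Sum using (_⊎_; inj₁; inj₂)
open import Relation.Binary.Definitions using (DecidableEquality)
open import Relation.Binary.PropositionalEquality using (_≡_; refl; sym; cong; subst)
open import Relation.Nullary using (yes; no; ¬_)
open import Defs using (Reduces; SeqIdem; ParIdem; ∅H)

module BiKA (A : Set) where

  open Defs hiding
    (Term; Exp; Lang; Hyp; Ctx; _≈E_; _⊆L_; _≐L_; ⟦_⟧; plug; HStar; _⊢_≐_; _⊢_≤_)

  Term : Set
  Term = Defs.Term A

  Exp : Set
  Exp = Defs.Exp A

  Lang : Set₁
  Lang = Defs.Lang A

  Hyp : Set₁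
  Hyp = Defs.Hyp A

  Ctx : Set
  Ctx = Defs.Ctx A

  infix 4 _≈E_ _⊆L_ _≐L_
  _≈E_ : Term → Term → Set
  _≈E_ = Defs._≈E_ A

  _⊆L_ _≐L_ : Lang → Lang → Set
  _⊆L_ = Defs._⊆L_ A
  _≐L_ = Defs._≐L_ A

  ⟦_⟧ : Exp → Lang
  ⟦_⟧ = Defs.⟦_⟧ A

  plug : Ctx → Term → Term
  plug = Defs.plug A

  HStar : Hyp → Lang → Lang
  HStar = Defs.HStar A

  infix 3 _⊢_≐_ _⊢_≤_
  _⊢_≐_ _⊢_≤_ : Hyp → Exp → Exp → Set
  _⊢_≐_ = Defs._⊢_≐_ A
  _⊢_≤_ = Defs._⊢_≤_ A

  private variable
    s s' t t' u u' : Term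
    e f g : Exp
    H H' : Hyp
    L M N : Lang

  data Op : Set where
    seq par : Op

  infix 5 _⟨_⟩_
  _⟨_⟩_ : Term → Op → Term → Term
  s ⟨ seq ⟩ t = s · t
  s ⟨ par ⟩ t = s ∥ t

  infix 6 _⟪_⟫_
  _⟪_⟫_ : Exp → Op → Exp → Exp
  e ⟪ seq ⟫ f = e ⊙ f
  e ⟪ par ⟫ f = e ∣∣ f

  star : Op → Exp → Exp
  star seq e = e ⋆
  star par e = e ⋆∥

  -- Idem seq a and Idem par a are definitionally SeqIdem A a and ParIdem A a.
  Idem : Op → A → Hyp
  Idem o a e f = (e ≡ var a ⟪ o ⟫ var a) × (f ≡ var a)

  ⟨⟩-cong : ∀ o → s ≈E s' → t ≈E t' → s ⟨ o ⟩ t ≈E s' ⟨ o ⟩ t'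
  ⟨⟩-cong seq = ·-cong
  ⟨⟩-cong par = ∥-cong

  ⟨⟩-assoc : ∀ o s t u → (s ⟨ o ⟩ t) ⟨ o ⟩ u ≈E s ⟨ o ⟩ (t ⟨ o ⟩ u)
  ⟨⟩-assoc seq = ·-assoc
  ⟨⟩-assoc par = ∥-assoc

  ⟨⟩-unitʳ : ∀ o t → t ⟨ o ⟩ one ≈E t
  ⟨⟩-unitʳ seq = ·-unitʳ
  ⟨⟩-unitʳ par t = E-trans (∥-comm t one) (∥-unitˡ t)

  sem-mul : ∀ o → ⟦ e ⟧ s → ⟦ f ⟧ t → ⟦ e ⟪ o ⟫ f ⟧ (s ⟨ o ⟩ t)
  sem-mul seq = sem-seq
  sem-mul par = sem-par

  sem-star-nil : ∀ o → ⟦ star o e ⟧ one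
  sem-star-nil seq = sem-star0
  sem-star-nil par = sem-pstar0

  sem-star-cons : ∀ o → ⟦ e ⟧ s → ⟦ star o e ⟧ t → ⟦ star o e ⟧ (s ⟨ o ⟩ t)
  sem-star-cons seq = sem-starS
  sem-star-cons par = sem-pstarS

  sem-var-inv : ∀ {x} → ⟦ var x ⟧ t → atom x ≈E t
  sem-var-inv (sem-var x) = E-refl (atom x)
  sem-var-inv (sem-E p q) = E-trans (sem-var-inv p) q

  sem-mul-inv : ∀ o → ⟦ e ⟪ o ⟫ f ⟧ t → ∃₂ λ s u → ⟦ e ⟧ s × ⟦ f ⟧ u × s ⟨ o ⟩ u ≈E t
  sem-mul-inv seq (sem-seq p q) = _ , _ , p , q , E-refl _
  sem-mul-inv par (sem-par p q) = _ , _ , p , q , E-refl _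
  sem-mul-inv o (sem-E p q) =
    let s , u , ps , pu , su≈ = sem-mul-inv o p in s , u , ps , pu , E-trans su≈ q

  sem-plus⊆star : ∀ o → ⟦ e ⟪ o ⟫ star o e ⟧ ⊆L ⟦ star o e ⟧
  sem-plus⊆star o _ p =
    let _ , _ , ps , pu , su≈ = sem-mul-inv o p in sem-E (sem-star-cons o ps pu) su≈

  module _ {e : Exp} (P : Lang) (P-resp : ∀ {s t} → s ≈E t → P s → P t) (P-one : P one) where

    sem-star-ind : ∀ o → (∀ {s t} → ⟦ e ⟧ s → P t → P (s ⟨ o ⟩ t)) → ⟦ star o e ⟧ ⊆L P
    sem-star-ind seq P-cons _ sem-star0 = P-one
    sem-star-ind seq P-cons _ (sem-starS p q) = P-cons p (sem-star-ind seq P-cons _ q)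
    sem-star-ind par P-cons _ sem-pstar0 = P-one
    sem-star-ind par P-cons _ (sem-pstarS p q) = P-cons p (sem-star-ind par P-cons _ q)
    sem-star-ind o P-cons _ (sem-E p q) = P-resp q (sem-star-ind o P-cons _ p)

  infixr 9 _∘ᶜ_
  _∘ᶜ_ : Ctx → Ctx → Ctx
  hole ∘ᶜ C = C
  (D ·ˡ t) ∘ᶜ C = (D ∘ᶜ C) ·ˡ t
  (t ·ʳ D) ∘ᶜ C = t ·ʳ (D ∘ᶜ C)
  (D ∥ˡ t) ∘ᶜ C = (D ∘ᶜ C) ∥ˡ t
  (t ∥ʳ D) ∘ᶜ C = t ∥ʳ (D ∘ᶜ C)

  plug-∘ᶜ : ∀ D C t → plug (D ∘ᶜ C) t ≡ plug D (plug C t)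
  plug-∘ᶜ hole C t = refl
  plug-∘ᶜ (D ·ˡ u) C t = cong (_· u) (plug-∘ᶜ D C t)
  plug-∘ᶜ (u ·ʳ D) C t = cong (u ·_) (plug-∘ᶜ D C t)
  plug-∘ᶜ (D ∥ˡ u) C t = cong (_∥ u) (plug-∘ᶜ D C t)
  plug-∘ᶜ (u ∥ʳ D) C t = cong (u ∥_) (plug-∘ᶜ D C t)

  plug-cong : ∀ C → s ≈E t → plug C s ≈E plug C t
  plug-cong hole s≈t = s≈t
  plug-cong (C ·ˡ u) s≈t = ·-cong (plug-cong C s≈t) (E-refl u)
  plug-cong (u ·ʳ C) s≈t = ·-cong (E-refl u) (plug-cong C s≈t)
  plug-cong (C ∥ˡ u) s≈t = ∥-cong (plug-cong C s≈t) (E-refl u)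
  plug-cong (u ∥ʳ C) s≈t = ∥-cong (E-refl u) (plug-cong C s≈t)

  HStar-bindᶜ : ∀ D → (∀ s → L s → HStar H M (plug D s)) →
                ∀ s → HStar H L s → HStar H M (plug D s)
  HStar-bindᶜ D k _ (hs-base p) = k _ p
  HStar-bindᶜ D k _ (hs-E p q) = hs-E (HStar-bindᶜ D k _ p) (plug-cong D q)
  HStar-bindᶜ {H = H} {M = M} D k _ (hs-hyp h C k' s p) =
    subst (HStar H M) (plug-∘ᶜ D C s)
      (hs-hyp h (D ∘ᶜ C)
        (λ t q → subst (HStar H M) (sym (plug-∘ᶜ D C t)) (HStar-bindᶜ D k _ (k' t q))) s p)

  HStar-bind : L ⊆L HStar H M → HStar H L ⊆L HStar H M
  HStar-bind = HStar-bindᶜ hole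

  HStar-map : L ⊆L M → HStar H L ⊆L HStar H M
  HStar-map L⊆M = HStar-bind λ t p → hs-base (L⊆M t p)

  HStar-mul : ∀ o → (∀ {v w} → L v → M w → HStar H N (v ⟨ o ⟩ w)) →
              HStar H L s → HStar H M t → HStar H N (s ⟨ o ⟩ t)
  HStar-mul seq k p q =
    HStar-bindᶜ (hole ·ˡ _) (λ s' ls → HStar-bindᶜ (s' ·ʳ hole) (λ _ mt → k ls mt) _ q) _ p
  HStar-mul par k p q =
    HStar-bindᶜ (hole ∥ˡ _) (λ s' ls → HStar-bindᶜ (s' ∥ʳ hole) (λ _ mt → k ls mt) _ q) _ p

  _⊆ᴴ_ : Hyp → Hyp → Set
  H ⊆ᴴ H' = ∀ {e f} → H e f → H' e f

  HStar-mono : H ⊆ᴴ H' → HStar H L ⊆L HStar H' L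
  HStar-mono H⊆H' _ (hs-base p) = hs-base p
  HStar-mono H⊆H' _ (hs-E p q) = hs-E (HStar-mono H⊆H' _ p) q
  HStar-mono H⊆H' _ (hs-hyp h C k s p) =
    hs-hyp (H⊆H' h) C (λ t q → HStar-mono H⊆H' _ (k t q)) s p

  ⊢-mono : H ⊆ᴴ H' → H ⊢ e ≐ f → H' ⊢ e ≐ f
  ⊢-mono H⊆H' ≐-refl = ≐-refl
  ⊢-mono H⊆H' (≐-sym p) = ≐-sym (⊢-mono H⊆H' p)
  ⊢-mono H⊆H' (≐-trans p q) = ≐-trans (⊢-mono H⊆H' p) (⊢-mono H⊆H' q)
  ⊢-mono H⊆H' (⊕-cong p q) = ⊕-cong (⊢-mono H⊆H' p) (⊢-mono H⊆H' q)
  ⊢-mono H⊆H' (⊙-cong p q) = ⊙-cong (⊢-mono H⊆H' p) (⊢-mono H⊆H' q)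
  ⊢-mono H⊆H' (∣∣-cong p q) = ∣∣-cong (⊢-mono H⊆H' p) (⊢-mono H⊆H' q)
  ⊢-mono H⊆H' (⋆-cong p) = ⋆-cong (⊢-mono H⊆H' p)
  ⊢-mono H⊆H' (⋆∥-cong p) = ⋆∥-cong (⊢-mono H⊆H' p)
  ⊢-mono H⊆H' ⊕-assoc = ⊕-assoc
  ⊢-mono H⊆H' ⊕-comm = ⊕-comm
  ⊢-mono H⊆H' ⊕-idem = ⊕-idem
  ⊢-mono H⊆H' ⊕-unit = ⊕-unit
  ⊢-mono H⊆H' ⊙-assoc = ⊙-assoc
  ⊢-mono H⊆H' ⊙-unitˡ = ⊙-unitˡ
  ⊢-mono H⊆H' ⊙-unitʳ = ⊙-unitʳ
  ⊢-mono H⊆H' ⊙-zeroˡ = ⊙-zeroˡ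
  ⊢-mono H⊆H' ⊙-zeroʳ = ⊙-zeroʳ
  ⊢-mono H⊆H' ⊙-distribˡ = ⊙-distribˡ
  ⊢-mono H⊆H' ⊙-distribʳ = ⊙-distribʳ
  ⊢-mono H⊆H' ∣∣-assoc = ∣∣-assoc
  ⊢-mono H⊆H' ∣∣-comm = ∣∣-comm
  ⊢-mono H⊆H' ∣∣-unit = ∣∣-unit
  ⊢-mono H⊆H' ∣∣-zero = ∣∣-zero
  ⊢-mono H⊆H' ∣∣-distrib = ∣∣-distrib
  ⊢-mono H⊆H' ⋆-unfoldˡ = ⋆-unfoldˡ
  ⊢-mono H⊆H' ⋆-unfoldʳ = ⋆-unfoldʳ
  ⊢-mono H⊆H' (⋆-indˡ p) = ⋆-indˡ (⊢-mono H⊆H' p)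
  ⊢-mono H⊆H' (⋆-indʳ p) = ⋆-indʳ (⊢-mono H⊆H' p)
  ⊢-mono H⊆H' ⋆∥-unfold = ⋆∥-unfold
  ⊢-mono H⊆H' (⋆∥-ind p) = ⋆∥-ind (⊢-mono H⊆H' p)
  ⊢-mono H⊆H' (hyp h) = hyp (H⊆H' h)

  ≐⇒≤ : H ⊢ e ≐ f → H ⊢ e ≤ f
  ≐⇒≤ e≐f = ≐-trans (⊕-cong e≐f ≐-refl) ⊕-idem

  ≤-refl : H ⊢ e ≤ e
  ≤-refl = ⊕-idem

  ≤-trans : H ⊢ e ≤ f → H ⊢ f ≤ g → H ⊢ e ≤ g
  ≤-trans e≤f f≤g =
    ≐-trans (⊕-cong ≐-refl (≐-sym f≤g))
            (≐-trans (≐-sym ⊕-assoc) (≐-trans (⊕-cong e≤f ≐-refl) f≤g))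

  ≤-antisym : H ⊢ e ≤ f → H ⊢ f ≤ e → H ⊢ e ≐ f
  ≤-antisym e≤f f≤e = ≐-trans (≐-sym f≤e) (≐-trans ⊕-comm e≤f)

  e≤e⊕f : H ⊢ e ≤ e ⊕ f
  e≤e⊕f = ≐-trans (≐-sym ⊕-assoc) (⊕-cong ⊕-idem ≐-refl)

  ⊕-least : H ⊢ e ≤ g → H ⊢ f ≤ g → H ⊢ e ⊕ f ≤ g
  ⊕-least e≤g f≤g = ≐-trans ⊕-assoc (≐-trans (⊕-cong ≐-refl f≤g) e≤g)

  ⊙-monoʳ-≤ : H ⊢ f ≤ g → H ⊢ e ⊙ f ≤ e ⊙ g
  ⊙-monoʳ-≤ f≤g = ≐-trans (≐-sym ⊙-distribˡ) (⊙-cong ≐-refl f≤g)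

  ∣∣-monoʳ-≤ : H ⊢ f ≤ g → H ⊢ e ∣∣ f ≤ e ∣∣ g
  ∣∣-monoʳ-≤ f≤g = ≐-trans (≐-sym ∣∣-distrib) (∣∣-cong ≐-refl f≤g)

  subidem⇒plus≐ : ∀ o → H ⊢ e ⟪ o ⟫ e ≤ e → H ⊢ e ⟪ o ⟫ star o e ≐ e
  subidem⇒plus≐ seq ee≤e =
    ≤-antisym (⋆-indʳ (⊕-least ≤-refl ee≤e))
              (≤-trans (≐⇒≤ (≐-sym ⊙-unitʳ)) (⊙-monoʳ-≤ (≤-trans e≤e⊕f ⋆-unfoldˡ)))
  subidem⇒plus≐ par ee≤e =
    ≤-antisym (≤-trans (≐⇒≤ ∣∣-comm) (⋆∥-ind (⊕-least ≤-refl ee≤e)))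
              (≤-trans (≐⇒≤ (≐-trans (≐-sym ∣∣-unit) ∣∣-comm))
                       (∣∣-monoʳ-≤ (≤-trans e≤e⊕f ⋆∥-unfold)))

  reduction-to-∅ : ∀ H (r : Exp → Exp) → (∀ e → H ⊢ r e ≐ e) →
                   (∀ e → HStar H ⟦ e ⟧ ≐L ⟦ r e ⟧) → Reduces A H (∅H A)
  reduction-to-∅ H r r≐id closure = record
    { r = r
    ; i = λ e → e
    ; ι = λ (L , L-closed) → L , λ t p → L-closed t (HStar-mono (λ ()) t p)
    ; ι-ext = λ _ _ L≐M → L≐M
    ; i-hom = λ _ _ (e≤f , f≤e) → ⊢-mono (λ ()) e≤f , ⊢-mono (λ ()) f≤e
    ; i∘r = λ e → ≐⇒≤ (r≐id e) , ≐⇒≤ (≐-sym (r≐id e))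
    ; ι-r = λ e → (λ t p → hs-base (proj₁ (closure e) t p))
                , (λ t p → HStar-bind (proj₂ (closure e)) t (HStar-mono (λ ()) t p))
    }

  module Replacement (a : A) (P : Lang) where

    infix 4 _▷_
    data _▷_ : Term → Term → Set where
      ▷atom : ∀ x → atom x ▷ atom x
      ▷a    : P t → atom a ▷ t
      ▷one  : one ▷ one
      ▷seq  : s ▷ s' → t ▷ t' → s · t ▷ s' · t'
      ▷par  : s ▷ s' → t ▷ t' → s ∥ t ▷ s' ∥ t'

    ▷-refl : ∀ t → t ▷ t
    ▷-refl (atom x) = ▷atom x
    ▷-refl one = ▷one
    ▷-refl (s · t) = ▷seq (▷-refl s) (▷-refl t)
    ▷-refl (s ∥ t) = ▷par (▷-refl s) (▷-refl t)

    plug-▷ : ∀ C → s ▷ t → plug C s ▷ plug C t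
    plug-▷ hole s▷t = s▷t
    plug-▷ (C ·ˡ u) s▷t = ▷seq (plug-▷ C s▷t) (▷-refl u)
    plug-▷ (u ·ʳ C) s▷t = ▷seq (▷-refl u) (plug-▷ C s▷t)
    plug-▷ (C ∥ˡ u) s▷t = ▷par (plug-▷ C s▷t) (▷-refl u)
    plug-▷ (u ∥ʳ C) s▷t = ▷par (▷-refl u) (plug-▷ C s▷t)

    ▷-mul-inv : ∀ o → s ⟨ o ⟩ t ▷ u → ∃₂ λ s' t' → s ▷ s' × t ▷ t' × u ≡ s' ⟨ o ⟩ t'
    ▷-mul-inv seq (▷seq x y) = _ , _ , x , y , refl
    ▷-mul-inv par (▷par x y) = _ , _ , x , y , refl

    Simulates : Term → Term → Set
    Simulates s t = ∀ {s'} → s ▷ s' → ∃[ t' ] t ▷ t' × s' ≈E t'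

    Simulates-trans : Simulates s t → Simulates t u → Simulates s u
    Simulates-trans sim₁ sim₂ x =
      let _ , y , e₁ = sim₁ x ; t' , z , e₂ = sim₂ y in t' , z , E-trans e₁ e₂

    Simulates-· : Simulates s s' → Simulates t t' → Simulates (s · t) (s' · t')
    Simulates-· sim₁ sim₂ (▷seq x y) =
      let _ , x' , e₁ = sim₁ x ; _ , y' , e₂ = sim₂ y in _ , ▷seq x' y' , ·-cong e₁ e₂

    Simulates-∥ : Simulates s s' → Simulates t t' → Simulates (s ∥ t) (s' ∥ t')
    Simulates-∥ sim₁ sim₂ (▷par x y) =
      let _ , x' , e₁ = sim₁ x ; _ , y' , e₂ = sim₂ y in _ , ▷par x' y' , ∥-cong e₁ e₂

    ≈E-simulation : s ≈E t → Simulates s t × Simulates t s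
    ≈E-simulation (·-assoc _ _ _) =
      (λ { (▷seq (▷seq x y) z) → _ , ▷seq x (▷seq y z) , ·-assoc _ _ _ }) ,
      (λ { (▷seq x (▷seq y z)) → _ , ▷seq (▷seq x y) z , E-sym (·-assoc _ _ _) })
    ≈E-simulation (·-unitˡ _) =
      (λ { (▷seq ▷one y) → _ , y , ·-unitˡ _ }) , (λ y → _ , ▷seq ▷one y , E-sym (·-unitˡ _))
    ≈E-simulation (·-unitʳ _) =
      (λ { (▷seq y ▷one) → _ , y , ·-unitʳ _ }) , (λ y → _ , ▷seq y ▷one , E-sym (·-unitʳ _))
    ≈E-simulation (∥-assoc _ _ _) =
      (λ { (▷par (▷par x y) z) → _ , ▷par x (▷par y z) , ∥-assoc _ _ _ }) ,
      (λ { (▷par x (▷par y z)) → _ , ▷par (▷par x y) z , E-sym (∥-assoc _ _ _) })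
    ≈E-simulation (∥-comm _ _) =
      (λ { (▷par x y) → _ , ▷par y x , ∥-comm _ _ }) ,
      (λ { (▷par x y) → _ , ▷par y x , ∥-comm _ _ })
    ≈E-simulation (∥-unitˡ _) =
      (λ { (▷par ▷one y) → _ , y , ∥-unitˡ _ }) , (λ y → _ , ▷par ▷one y , E-sym (∥-unitˡ _))
    ≈E-simulation (E-refl _) = (λ x → _ , x , E-refl _) , (λ x → _ , x , E-refl _)
    ≈E-simulation (E-sym p) = swap (≈E-simulation p)
    ≈E-simulation (E-trans p q) =
      let f₁ , b₁ = ≈E-simulation p ; f₂ , b₂ = ≈E-simulation q
      in Simulates-trans f₁ f₂ , Simulates-trans b₂ b₁
    ≈E-simulation (·-cong p q) =
      let f₁ , b₁ = ≈E-simulation p ; f₂ , b₂ = ≈E-simulation q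
      in Simulates-· f₁ f₂ , Simulates-· b₁ b₂
    ≈E-simulation (∥-cong p q) =
      let f₁ , b₁ = ≈E-simulation p ; f₂ , b₂ = ≈E-simulation q
      in Simulates-∥ f₁ f₂ , Simulates-∥ b₁ b₂

    ▷-back : s ≈E t → t ▷ t' → ∃[ s' ] s ▷ s' × s' ≈E t'
    ▷-back s≈t x = let s' , y , t'≈s' = proj₂ (≈E-simulation s≈t) x in s' , y , E-sym t'≈s'

    ▷-Closed : Lang → Set
    ▷-Closed L = ∀ {t t'} → L t → t ▷ t' → L t'

    var-▷-closed : ∀ {x} → ¬ x ≡ a → ▷-Closed ⟦ var x ⟧
    var-▷-closed x≢a (sem-var x) (▷atom x) = sem-var x
    var-▷-closed x≢a (sem-var _) (▷a _) = ⊥-elim (x≢a refl)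
    var-▷-closed x≢a (sem-E p q) r =
      let _ , r' , eq = ▷-back q r in sem-E (var-▷-closed x≢a p r') eq

  module Substitution (_≟_ : DecidableEquality A) where

    infix 9 _[_≔_]
    _[_≔_] : Exp → A → Exp → Exp
    𝟘 [ a ≔ g ] = 𝟘
    𝟙 [ a ≔ g ] = 𝟙
    var x [ a ≔ g ] with x ≟ a
    ... | yes _ = g
    ... | no _ = var x
    (e ⊕ f) [ a ≔ g ] = e [ a ≔ g ] ⊕ f [ a ≔ g ]
    (e ⊙ f) [ a ≔ g ] = e [ a ≔ g ] ⊙ f [ a ≔ g ]
    (e ∣∣ f) [ a ≔ g ] = e [ a ≔ g ] ∣∣ f [ a ≔ g ]
    (e ⋆) [ a ≔ g ] = e [ a ≔ g ] ⋆
    (e ⋆∥) [ a ≔ g ] = e [ a ≔ g ] ⋆∥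

    module _ (a : A) (g : Exp) where

      [≔]-≐ : H ⊢ g ≐ var a → ∀ e → H ⊢ e [ a ≔ g ] ≐ e
      [≔]-≐ g≐a 𝟘 = ≐-refl
      [≔]-≐ g≐a 𝟙 = ≐-refl
      [≔]-≐ g≐a (var x) with x ≟ a
      ... | yes refl = g≐a
      ... | no _ = ≐-refl
      [≔]-≐ g≐a (e ⊕ f) = ⊕-cong ([≔]-≐ g≐a e) ([≔]-≐ g≐a f)
      [≔]-≐ g≐a (e ⊙ f) = ⊙-cong ([≔]-≐ g≐a e) ([≔]-≐ g≐a f)
      [≔]-≐ g≐a (e ∣∣ f) = ∣∣-cong ([≔]-≐ g≐a e) ([≔]-≐ g≐a f)
      [≔]-≐ g≐a (e ⋆) = ⋆-cong ([≔]-≐ g≐a e)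
      [≔]-≐ g≐a (e ⋆∥) = ⋆∥-cong ([≔]-≐ g≐a e)

      [≔]-sound : ⟦ g ⟧ ⊆L HStar H ⟦ var a ⟧ → ∀ e → ⟦ e [ a ≔ g ] ⟧ ⊆L HStar H ⟦ e ⟧
      [≔]-sound g⊆a 𝟙 _ sem-one = hs-base sem-one
      [≔]-sound g⊆a (var x) with x ≟ a
      ... | yes refl = g⊆a
      ... | no _ = λ _ → hs-base
      [≔]-sound g⊆a (e ⊕ f) _ (sem-inl p) = HStar-map (λ _ → sem-inl) _ ([≔]-sound g⊆a e _ p)
      [≔]-sound g⊆a (e ⊕ f) _ (sem-inr p) = HStar-map (λ _ → sem-inr) _ ([≔]-sound g⊆a f _ p)
      [≔]-sound g⊆a (e ⊙ f) _ (sem-seq p q) =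
        HStar-mul seq (λ x y → hs-base (sem-seq x y)) ([≔]-sound g⊆a e _ p) ([≔]-sound g⊆a f _ q)
      [≔]-sound g⊆a (e ∣∣ f) _ (sem-par p q) =
        HStar-mul par (λ x y → hs-base (sem-par x y)) ([≔]-sound g⊆a e _ p) ([≔]-sound g⊆a f _ q)
      [≔]-sound g⊆a (e ⋆) _ sem-star0 = hs-base sem-star0
      [≔]-sound g⊆a (e ⋆) _ (sem-starS p q) =
        HStar-mul seq (λ x y → hs-base (sem-starS x y))
          ([≔]-sound g⊆a e _ p) ([≔]-sound g⊆a (e ⋆) _ q)
      [≔]-sound g⊆a (e ⋆∥) _ sem-pstar0 = hs-base sem-pstar0
      [≔]-sound g⊆a (e ⋆∥) _ (sem-pstarS p q) =
        HStar-mul par (λ x y → hs-base (sem-pstarS x y))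
          ([≔]-sound g⊆a e _ p) ([≔]-sound g⊆a (e ⋆∥) _ q)
      [≔]-sound g⊆a e _ (sem-E p q) = hs-E ([≔]-sound g⊆a e _ p) q

      [≔]-extensive : ⟦ var a ⟧ ⊆L ⟦ g ⟧ → ∀ e → ⟦ e ⟧ ⊆L ⟦ e [ a ≔ g ] ⟧
      [≔]-extensive a⊆g 𝟙 _ sem-one = sem-one
      [≔]-extensive a⊆g (var x) with x ≟ a
      ... | yes refl = a⊆g
      ... | no _ = λ _ p → p
      [≔]-extensive a⊆g (e ⊕ f) _ (sem-inl p) = sem-inl ([≔]-extensive a⊆g e _ p)
      [≔]-extensive a⊆g (e ⊕ f) _ (sem-inr p) = sem-inr ([≔]-extensive a⊆g f _ p)
      [≔]-extensive a⊆g (e ⊙ f) _ (sem-seq p q) =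
        sem-seq ([≔]-extensive a⊆g e _ p) ([≔]-extensive a⊆g f _ q)
      [≔]-extensive a⊆g (e ∣∣ f) _ (sem-par p q) =
        sem-par ([≔]-extensive a⊆g e _ p) ([≔]-extensive a⊆g f _ q)
      [≔]-extensive a⊆g (e ⋆) _ sem-star0 = sem-star0
      [≔]-extensive a⊆g (e ⋆) _ (sem-starS p q) =
        sem-starS ([≔]-extensive a⊆g e _ p) ([≔]-extensive a⊆g (e ⋆) _ q)
      [≔]-extensive a⊆g (e ⋆∥) _ sem-pstar0 = sem-pstar0
      [≔]-extensive a⊆g (e ⋆∥) _ (sem-pstarS p q) =
        sem-pstarS ([≔]-extensive a⊆g e _ p) ([≔]-extensive a⊆g (e ⋆∥) _ q)
      [≔]-extensive a⊆g e _ (sem-E p q) = sem-E ([≔]-extensive a⊆g e _ p) q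

      module _ (P : Lang) where
        open Replacement a P

        [≔]-▷-closed : ▷-Closed ⟦ g ⟧ → ∀ e → ▷-Closed ⟦ e [ a ≔ g ] ⟧
        [≔]-▷-closed g-closed 𝟙 sem-one ▷one = sem-one
        [≔]-▷-closed g-closed (var x) with x ≟ a
        ... | yes refl = g-closed
        ... | no x≢a = var-▷-closed x≢a
        [≔]-▷-closed g-closed (e ⊕ f) (sem-inl p) r = sem-inl ([≔]-▷-closed g-closed e p r)
        [≔]-▷-closed g-closed (e ⊕ f) (sem-inr p) r = sem-inr ([≔]-▷-closed g-closed f p r)
        [≔]-▷-closed g-closed (e ⊙ f) (sem-seq p q) (▷seq x y) =
          sem-seq ([≔]-▷-closed g-closed e p x) ([≔]-▷-closed g-closed f q y)
        [≔]-▷-closed g-closed (e ∣∣ f) (sem-par p q) (▷par x y) =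
          sem-par ([≔]-▷-closed g-closed e p x) ([≔]-▷-closed g-closed f q y)
        [≔]-▷-closed g-closed (e ⋆) sem-star0 ▷one = sem-star0
        [≔]-▷-closed g-closed (e ⋆) (sem-starS p q) (▷seq x y) =
          sem-starS ([≔]-▷-closed g-closed e p x) ([≔]-▷-closed g-closed (e ⋆) q y)
        [≔]-▷-closed g-closed (e ⋆∥) sem-pstar0 ▷one = sem-pstar0
        [≔]-▷-closed g-closed (e ⋆∥) (sem-pstarS p q) (▷par x y) =
          sem-pstarS ([≔]-▷-closed g-closed e p x) ([≔]-▷-closed g-closed (e ⋆∥) q y)
        [≔]-▷-closed g-closed e (sem-E p q) r =
          let _ , r' , eq = ▷-back q r in sem-E ([≔]-▷-closed g-closed e p r') eq

  module Idempotence (_≟_ : DecidableEquality A) (a : A) (o : Op) where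
    open Substitution _≟_

    a⁺ : Exp
    a⁺ = var a ⟪ o ⟫ star o (var a)

    a⁺≐a : Idem o a ⊢ a⁺ ≐ var a
    a⁺≐a = subidem⇒plus≐ o (hyp (refl , refl))

    data Power : Lang where
      base : Power (atom a)
      step : Power s → Power t → Power (s ⟨ o ⟩ t)

    Powers : Lang
    Powers t = ∃[ u ] Power u × u ≈E t

    cons-Powers : ⟦ var a ⟧ s → one ≈E t ⊎ Powers t → Powers (s ⟨ o ⟩ t)
    cons-Powers p (inj₁ one≈t) =
      atom a , base , E-trans (E-sym (⟨⟩-unitʳ o (atom a))) (⟨⟩-cong o (sem-var-inv p) one≈t)
    cons-Powers p (inj₂ (u , pu , u≈t)) =
      atom a ⟨ o ⟩ u , step base pu , ⟨⟩-cong o (sem-var-inv p) u≈t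

    a⋆⊆one∪Powers : ⟦ star o (var a) ⟧ ⊆L λ t → one ≈E t ⊎ Powers t
    a⋆⊆one∪Powers = sem-star-ind _ resp (inj₁ (E-refl one)) o λ p q → inj₂ (cons-Powers p q)
      where
      resp : s ≈E t → one ≈E s ⊎ Powers s → one ≈E t ⊎ Powers t
      resp s≈t (inj₁ one≈s) = inj₁ (E-trans one≈s s≈t)
      resp s≈t (inj₂ (u , pu , u≈s)) = inj₂ (u , pu , E-trans u≈s s≈t)

    a⁺⊆Powers : ⟦ a⁺ ⟧ ⊆L Powers
    a⁺⊆Powers _ p =
      let _ , _ , ps , pv , sv≈t = sem-mul-inv o p
          u , pu , u≈sv = cons-Powers ps (a⋆⊆one∪Powers _ pv)
      in u , pu , E-trans u≈sv sv≈t

    Powers⊆a⁺ : Powers ⊆L ⟦ a⁺ ⟧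
    Powers⊆a⁺ _ (u , pu , u≈t) = sem-E (sem-E (power⟨⟩a⋆ pu (sem-star-nil o)) (⟨⟩-unitʳ o u)) u≈t
      where
      power⟨⟩a⋆ : ∀ {v w} → Power v → ⟦ star o (var a) ⟧ w → ⟦ a⁺ ⟧ (v ⟨ o ⟩ w)
      power⟨⟩a⋆ base q = sem-mul o (sem-var a) q
      power⟨⟩a⋆ (step p₁ p₂) q =
        sem-E (power⟨⟩a⋆ p₁ (sem-plus⊆star o _ (power⟨⟩a⋆ p₂ q))) (E-sym (⟨⟩-assoc o _ _ _))

    var-a⊆a⁺ : ⟦ var a ⟧ ⊆L ⟦ a⁺ ⟧
    var-a⊆a⁺ t p = Powers⊆a⁺ t (atom a , base , sem-var-inv p)

    Power⊆HStar-a : Power ⊆L HStar (Idem o a) ⟦ var a ⟧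
    Power⊆HStar-a _ base = hs-base (sem-var a)
    Power⊆HStar-a _ (step p q) = HStar-mul o idem-step (Power⊆HStar-a _ p) (Power⊆HStar-a _ q)
      where
      idem-step : ∀ {v w} → ⟦ var a ⟧ v → ⟦ var a ⟧ w → HStar (Idem o a) ⟦ var a ⟧ (v ⟨ o ⟩ w)
      idem-step p q = hs-hyp (refl , refl) hole (λ _ → hs-base) _ (sem-mul o p q)

    a⁺⊆HStar-a : ⟦ a⁺ ⟧ ⊆L HStar (Idem o a) ⟦ var a ⟧
    a⁺⊆HStar-a t p = let u , pu , u≈t = a⁺⊆Powers t p in hs-E (Power⊆HStar-a u pu) u≈t

    open Replacement a Power

    Power-▷ : Power u → u ▷ u' → Power u'
    Power-▷ base (▷atom _) = base
    Power-▷ base (▷a p) = p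
    Power-▷ (step p q) r with ▷-mul-inv o r
    ... | _ , _ , x , y , refl = step (Power-▷ p x) (Power-▷ q y)

    a⁺-▷-closed : ▷-Closed ⟦ a⁺ ⟧
    a⁺-▷-closed p r =
      let u , pu , u≈t = a⁺⊆Powers _ p
          u' , r' , u'≈t' = ▷-back u≈t r
      in Powers⊆a⁺ _ (u' , Power-▷ pu r' , u'≈t')

    HStar-Idem⊆ : ▷-Closed ⟦ f ⟧ → L ⊆L ⟦ f ⟧ → HStar (Idem o a) L ⊆L ⟦ f ⟧
    HStar-Idem⊆ closed L⊆f _ (hs-base p) = L⊆f _ p
    HStar-Idem⊆ closed L⊆f _ (hs-E p q) = sem-E (HStar-Idem⊆ closed L⊆f _ p) q
    HStar-Idem⊆ closed L⊆f _ (hs-hyp (refl , refl) C k s p) =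
      sem-E (closed (HStar-Idem⊆ closed L⊆f _ (k (atom a) (sem-var a)))
                    (plug-▷ C (▷a (step base base))))
            (plug-cong C aa≈s)
      where
      aa≈s : atom a ⟨ o ⟩ atom a ≈E s
      aa≈s = let _ , _ , p₁ , p₂ , s₁s₂≈s = sem-mul-inv o p
             in E-trans (⟨⟩-cong o (sem-var-inv p₁) (sem-var-inv p₂)) s₁s₂≈s

    HStar-Idem≐subst : ∀ e → HStar (Idem o a) ⟦ e ⟧ ≐L ⟦ e [ a ≔ a⁺ ] ⟧
    HStar-Idem≐subst e =
      HStar-Idem⊆ ([≔]-▷-closed a a⁺ Power a⁺-▷-closed e) ([≔]-extensive a a⁺ var-a⊆a⁺ e) ,
      [≔]-sound a a⁺ a⁺⊆HStar-a e

    Idem-reduces : Reduces A (Idem o a) (∅H A)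
    Idem-reduces =
      reduction-to-∅ (Idem o a) (λ e → e [ a ≔ a⁺ ]) ([≔]-≐ a a⁺ a⁺≐a) HStar-Idem≐subst

lemma7p2 : (A : Set) → DecidableEquality A → (a : A) →
    Reduces A (SeqIdem A a) (∅H A) × Reduces A (ParIdem A a) (∅H A)
lemma7p2 A _≟_ a = Idem-reduces seq , Idem-reduces par
  where
  open BiKA A using (seq; par)
  open BiKA.Idempotence A _≟_ a using (Idem-reduces)
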